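{- Let $H$ be a digraph (possibly with loops), $D$ an $H$-colored digraph with no isolated vertices, $\mathscr{F}$ a walk-preservative $H$-class partition of $A(D)$, and $\mathcal{S}$ a $(k,l)$-kernel in $C_{\mathscr{F}}(D)$ with $k\geq 3$ and $l\geq 1$. If for every $F\in\mathcal{S}$, $D\langle F\rangle$ is unilateral and has no sinks, then every kernel by paths in $D\langle\bigcup_{F\in\mathcal{S}}F\rangle$ is a $(k-1,l+1,H)$-kernel by walks in $D$.
   Context: An $H$-colored digraph is a finite digraph $D$ without loops with a coloring $\rho:A(D)\to V(H)$. For $F\subseteq A(D)$, $D\langle F\rangle$ is the digraph with arc set $F$ and vertex set the vertices incident with an arc of $F$. An $H$-class partition of $A(D)$ is a partition $\mathscr{F}$ of $A(D)$ such that for all arcs $(u,v),(v,w)$ of $D$, $(\rho(u,v),\rho(v,w))\in A(H)$ iff some $F\in\mathscr{F}$ contains both arcs. The $H$-class digraph $C_{\mathscr{F}}(D)$ has vertex set $\mathscr{F}$, and $(F,G)$ (possibly a loop) is an arc iff there exist $(u,v)\in F$ and $(v,w)\in G$. $\mathscr{F}$ is walk-preservative if for every arc $(F,G)$ of $C_{\mathscr{F}}(D)$ and every $z\in V(D\langle F\rangle)$ there is a $zw$-path in $D\langle F\rangle$ for some $w\in V(D\langle G\rangle)$. A digraph is unilateral if any two vertices $u,v$ have a $uv$-path or a $vu$-path; a sink is a vertex with no out-going arc. A $(k,l)$-kernel of a digraph is a set $S$ such that every walk between two different vertices of $S$ has length at least $k$ and every vertex not in $S$ has a walk of length at most $l$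 to $S$. A kernel by paths is a vertex set $K$ with no path between two different vertices of $K$ and such that every vertex not in $K$ has a path to $K$. For a walk $W=(x_0,\ldots,x_n)$ in $D$, there is an obstruction on $x_i$ if $(\rho(x_{i-1},x_i),\rho(x_i,x_{i+1}))\notin A(H)$; for open $W$, the $H$-length is $1$ plus the number of $i\in\{1,\ldots,n-1\}$ with an obstruction on $x_i$. A set $S\subseteq V(D)$ is a $(k,l,H)$-kernel by walks if every walk between two different vertices of $S$ has $H$-length at least $k$ and every $x\notin S$ has a walk to $S$ of $H$-length at most $l$. -}

module Defs where

open import Data.Nat using (ℕ; zero; suc; _+_; _≤_)
open import Data.Bool using (Bool; true; false; if_then_else_)
open import Data.Fin using (Fin)
open import Data.Fin.Subset using (Subset; _∈_; _∉_)
open import Data.List using (List; []; _∷_)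
open import Data.List.Relation.Unary.Unique.Propositional using (Unique)
open import Data.Product using (Σ; ∃; ∃₂; _×_; _,_)
open import Data.Sum using (_⊎_)
open import Relation.Nullary using (¬_)
open import Relation.Binary.PropositionalEquality using (_≡_; _≢_)
open import Function.Bundles using (_⇔_)

record Digraph : Set where
  field
    size : ℕ
    adj  : Fin size → Fin size → Bool
open Digraph public

Arc : (G : Digraph) → Fin (size G) → Fin (size G) → Set
Arc G u v = adj G u v ≡ true

Loopless : Digraph → Set
Loopless G = ∀ v → ¬ Arc G v v

NoIsolated : Digraph → Set
NoIsolated G = ∀ v → ∃ λ u → Arc G v u ⊎ Arc G u v

-- An H-coloring of the arcs of D.  Arcs are pairs (u , v) with Arc D u v;
-- values of ρ on non-arcs are irrelevant.
Coloring : Digraph → Digraph → Set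
Coloring D H = Fin (size D) → Fin (size D) → Fin (size H)

data Walk {A : Set} (R : A → A → Set) : A → A → Set where
  []  : ∀ {x} → Walk R x x
  _∷_ : ∀ {x y z} → R x y → Walk R y z → Walk R x z

len : ∀ {A : Set} {R : A → A → Set} {x y} → Walk R x y → ℕ
len []      = zero
len (_ ∷ w) = suc (len w)

verts : ∀ {A : Set} {R : A → A → Set} {x y} → Walk R x y → List A
verts {x = x} []      = x ∷ []
verts {x = x} (_ ∷ w) = x ∷ verts w

IsPath : ∀ {A : Set} {R : A → A → Set} {x y} → Walk R x y → Set
IsPath w = Unique (verts w)

Path : ∀ {A : Set} (R : A → A → Set) → A → A → Set
Path R x y = Σ (Walk R x y) IsPath

module _ (D H : Digraph) (ρ : Coloring D H) where

  obstructions : List (Fin (size D)) → ℕ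
  obstructions (a ∷ b ∷ c ∷ rest) =
    (if adj H (ρ a b) (ρ b c) then 0 else 1) + obstructions (b ∷ c ∷ rest)
  obstructions _ = 0

  Hlength : ∀ {x y} → Walk (Arc D) x y → ℕ
  Hlength w = suc (obstructions (verts w))

  IsKLHKernelByWalks : ℕ → ℕ → Subset (size D) → Set
  IsKLHKernelByWalks k l S =
    (∀ x y → x ∈ S → y ∈ S → x ≢ y → (w : Walk (Arc D) x y) → k ≤ Hlength w)
    × (∀ x → x ∉ S → ∃ λ y → y ∈ S × Σ (Walk (Arc D) x y) λ w → Hlength w ≤ l)

-- Partitions of A(D) into classes indexed by Fin m.
-- cls u v is the class of the arc (u , v) (irrelevant on non-arcs);
-- every class is nonempty.

module _ (D : Digraph) {m : ℕ} (cls : Fin (size D) → Fin (size D) → Fin m) where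

  IsArcPartition : Set
  IsArcPartition = ∀ i → ∃₂ λ u v → Arc D u v × cls u v ≡ i

  IsHClassPartition : (H : Digraph) → Coloring D H → Set
  IsHClassPartition H ρ =
    IsArcPartition
    × (∀ u v w → Arc D u v → Arc D v w →
         (Arc H (ρ u v) (ρ v w) ⇔ cls u v ≡ cls v w))

  CArc : Fin m → Fin m → Set
  CArc i j = ∃ λ u → ∃ λ v → ∃ λ w →
    Arc D u v × Arc D v w × cls u v ≡ i × cls v w ≡ j

  SubArc : (Fin m → Set) → Fin (size D) → Fin (size D) → Set
  SubArc P u v = Arc D u v × P (cls u v)

  SubVert : (Fin m → Set) → Fin (size D) → Set
  SubVert P z = ∃ λ w → SubArc P z w ⊎ SubArc P w z

  ClassArc : Fin m → Fin (size D) → Fin (size D) → Set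
  ClassArc i = SubArc (λ j → j ≡ i)

  ClassVert : Fin m → Fin (size D) → Set
  ClassVert i = SubVert (λ j → j ≡ i)

  WalkPreservative : Set
  WalkPreservative =
    ∀ i j → CArc i j → ∀ z → ClassVert i z →
      ∃ λ w → ClassVert j w × Path (ClassArc i) z w

  ClassUnilateral : Fin m → Set
  ClassUnilateral i = ∀ u v → ClassVert i u → ClassVert i v →
    Path (ClassArc i) u v ⊎ Path (ClassArc i) v u

  ClassNoSinks : Fin m → Set
  ClassNoSinks i = ∀ u → ClassVert i u → ∃ λ v → ClassArc i u v

  IsKLKernelInC : ℕ → ℕ → Subset m → Set
  IsKLKernelInC k l S =
    (∀ i j → i ∈ S → j ∈ S → i ≢ j → (w : Walk CArc i j) → k ≤ len w)
    × (∀ i → i ∉ S → ∃ λ j → j ∈ S × Σ (Walk CArc i j) λ w → len w ≤ l)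

  IsKernelByPathsInUnion : Subset m → Subset (size D) → Set
  IsKernelByPathsInUnion S K =
    (∀ x → x ∈ K → SubVert (_∈ S) x)
    × (∀ x y → x ∈ K → y ∈ K → x ≢ y → ¬ Path (SubArc (_∈ S)) x y)
    × (∀ x → SubVert (_∈ S) x → x ∉ K →
         ∃ λ y → y ∈ K × Path (SubArc (_∈ S)) x y)

{-# OPTIONS --safe #-}
-- Since ℱ is an H-class partition, the H-length of a walk is one plus the
-- number of class changes between consecutive arcs, and each change is an arc
-- of C_ℱ(D).  Distinct classes of the kernel 𝒮 are not adjacent in C_ℱ(D), so
-- walks in D⟨⋃𝒮⟩ never change class.  A vertex outside K follows a C-walk of
-- length ≤ l into a class of 𝒮 (walk-preservation makes each C-step cost at
-- most one change) and then reaches K inside that class.  For distinct x, y ∈ K,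
-- extend an xy-walk by an 𝒮-arc into x and one out of y: by unilaterality
-- these lie in different classes, so the extension projects to a C-walk
-- between distinct members of 𝒮, of length ≥ k, yet it has at most one more
-- change than the H-length of the original walk.
module Submission where

open import Defs
open import Data.Nat using (ℕ; suc; _+_; _∸_; _≤_; z≤n; s≤s)
open import Data.Nat.Properties
  using (≤-refl; ≤-reflexive; ≤-trans; <⇒≱; <⇒≤; +-mono-≤; +-monoˡ-≤; +-suc; m≤n+m; ∸-monoˡ-≤; module ≤-Reasoning)
open import Data.Bool using (Bool; true; false; if_then_else_)
open import Data.Bool.Properties using (T-≡)
open import Data.Fin using (Fin; _≟_)
open import Data.Fin.Subset using (Subset; _∈_; _∉_)
open import Data.Fin.Subset.Properties using (_∈?_)
open import Data.List using ([]; _∷_)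
open import Data.List.Relation.Unary.Any using (here; there)
open import Data.List.Relation.Unary.All using ([]; _∷_)
open import Data.List.Relation.Unary.All.Properties.Core using (¬Any⇒All¬)
open import Data.List.Relation.Unary.AllPairs using ([]; _∷_)
open import Data.List.Relation.Unary.Unique.Propositional using (Unique)
import Data.List.Membership.Propositional as List
import Data.List.Membership.DecPropositional as DecMembership
open import Data.Product using (_×_; _,_; ∃; Σ; proj₁; proj₂)
open import Data.Sum using (_⊎_; inj₁; inj₂)
open import Data.Empty using (⊥; ⊥-elim)
open import Function using (_∘_)
open import Function.Bundles using (_⇔_; Equivalence)
open import Relation.Nullary using (¬_; Dec; does; proof; yes; no; contradiction)
open import Relation.Nullary.Decidable using (dec-true)
open import Relation.Nullary.Reflects using (det; fromEquivalence)
open import Relation.Binary.PropositionalEquality using (_≡_; _≢_; refl; sym; cong; cong₂; subst)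

module _ {A : Set} {R : A → A → Set} where

  _++ʷ_ : ∀ {x y z} → Walk R x y → Walk R y z → Walk R x z
  []      ++ʷ v = v
  (e ∷ w) ++ʷ v = e ∷ (w ++ʷ v)

  len-++ʷ : ∀ {x y z} (w : Walk R x y) (v : Walk R y z) → len (w ++ʷ v) ≡ len w + len v
  len-++ʷ []      v = refl
  len-++ʷ (e ∷ w) v = cong suc (len-++ʷ w v)

  target∈verts : ∀ {x y} (w : Walk R x y) → y List.∈ verts w
  target∈verts []      = here refl
  target∈verts (e ∷ w) = there (target∈verts w)

  arc-into-walk : ∀ {a c b x} → R a c → (w : Walk R c b) → x List.∈ verts w → ∃ λ v → R v x
  arc-into-walk e []      (here refl) = _ , e
  arc-into-walk e (f ∷ w) (here refl) = _ , e
  arc-into-walk e (f ∷ w) (there x∈w) = arc-into-walk f w x∈w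

  ∷-path : ∀ {x y z} (e : R x y) (p : Path R y z) → ¬ x List.∈ verts (proj₁ p) → Path R x z
  ∷-path e (w , w-unique) x∉w = e ∷ w , ¬Any⇒All¬ (verts w) x∉w ∷ w-unique

module _ {A : Set} {R R′ : A → A → Set} (f : ∀ {a b} → R a b → R′ a b) where

  mapʷ : ∀ {x y} → Walk R x y → Walk R′ x y
  mapʷ []      = []
  mapʷ (e ∷ w) = f e ∷ mapʷ w

  verts-mapʷ : ∀ {x y} (w : Walk R x y) → verts (mapʷ w) ≡ verts w
  verts-mapʷ []      = refl
  verts-mapʷ (e ∷ w) = cong (_ ∷_) (verts-mapʷ w)

  mapᵖ : ∀ {x y} → Path R x y → Path R′ x y
  mapᵖ (w , w-unique) = mapʷ w , subst Unique (sym (verts-mapʷ w)) w-unique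

≡true⇔⇒≡does : ∀ {b : Bool} {P : Set} → (b ≡ true ⇔ P) → (P? : Dec P) → b ≡ does P?
≡true⇔⇒≡does b⇔P P? =
  det (fromEquivalence (to b⇔P ∘ Equivalence.to T-≡) (Equivalence.from T-≡ ∘ from b⇔P)) (proof P?)
  where open Equivalence

module ClassChanges (D : Digraph) {m : ℕ} (cls : Fin (size D) → Fin (size D) → Fin m) where

  V : Set
  V = Fin (size D)

  differ : Fin m → Fin m → ℕ
  differ c d = if does (c ≟ d) then 0 else 1

  differ-≡ : ∀ {c d} → c ≡ d → differ c d ≡ 0
  differ-≡ {c} {d} c≡d rewrite dec-true (c ≟ d) c≡d = refl

  differ≤1 : ∀ c d → differ c d ≤ 1
  differ≤1 c d with does (c ≟ d)
  ... | true  = z≤n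
  ... | false = ≤-refl

  -- Class changes along a walk, including one at the first arc if it is not in class c.
  changes : Fin m → ∀ {x y} → Walk (Arc D) x y → ℕ
  changes c []                = 0
  changes c (_∷_ {x} {y} _ w) = differ c (cls x y) + changes (cls x y) w

  changes-shift : ∀ c d {x y} (w : Walk (Arc D) x y) → changes c w ≤ suc (changes d w)
  changes-shift c d []                = z≤n
  changes-shift c d (_∷_ {x} {y} _ w) =
    ≤-trans (+-monoˡ-≤ (changes (cls x y) w) (differ≤1 c (cls x y))) (s≤s (m≤n+m _ _))

  changes-after-class-walk : ∀ {c x y z} (p : Walk (ClassArc D cls c) x y) (w : Walk (Arc D) y z) →
    changes c (mapʷ proj₁ p ++ʷ w) ≡ changes c w
  changes-after-class-walk []               w = refl
  changes-after-class-walk {c} ((_ , refl) ∷ p) w =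
    cong₂ _+_ (differ-≡ {c} refl) (changes-after-class-walk p w)

  class-step : ∀ {c d} → CArc D cls c d → Σ (Walk (CArc D cls) c d) λ cw → len cw ≤ differ c d
  class-step {c} {d} cd with c ≟ d
  ... | yes refl = [] , z≤n
  ... | no _     = cd ∷ [] , ≤-refl

  class-walk : ∀ {u x y t} (e : Arc D u x) (w : Walk (Arc D) x y) (f : Arc D y t) →
    Σ (Walk (CArc D cls) (cls u x) (cls y t)) λ cw → len cw ≤ suc (changes (cls u x) w)
  class-walk {u} {x} e [] f with class-step (u , x , _ , e , f , refl , refl)
  ... | cw , bound = cw , ≤-trans bound (differ≤1 (cls u x) (cls x _))
  class-walk {u} {x} e (_∷_ {_} {z} g w) f with class-step (u , x , z , e , g , refl , refl) | class-walk g w f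
  ... | cw₁ , bound₁ | cw₂ , bound₂ = cw₁ ++ʷ cw₂ , (begin
    len (cw₁ ++ʷ cw₂)                                      ≡⟨ len-++ʷ cw₁ cw₂ ⟩
    len cw₁ + len cw₂                                      ≤⟨ +-mono-≤ bound₁ bound₂ ⟩
    differ (cls u x) (cls x z) + suc (changes (cls x z) w) ≡⟨ +-suc _ _ ⟩
    suc (changes (cls u x) (g ∷ w))                        ∎)
    where open ≤-Reasoning

  ReachesWithin : Subset (size D) → Fin m → ℕ → V → Set
  ReachesWithin K c n z = ∃ λ y → y ∈ K × Σ (Walk (Arc D) z y) λ w → changes c w ≤ n

  lift-class-walk : WalkPreservative D cls → ∀ {K c d} (cw : Walk (CArc D cls) c d) →
    (∀ w → ClassVert D cls d w → ReachesWithin K d 0 w) →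
    ∀ z → ClassVert D cls c z → ReachesWithin K c (len cw) z
  lift-class-walk wP []                          reach-d z z∈c = reach-d z z∈c
  lift-class-walk wP {c = c} (_∷_ {_} {c₁} cc₁ cw) reach-d z z∈c
    with wP c c₁ cc₁ z z∈c
  ... | w , w∈c₁ , p , _ with lift-class-walk wP cw reach-d w w∈c₁
  ...   | y , y∈K , v , bound = y , y∈K , mapʷ proj₁ p ++ʷ v , (begin
    changes c (mapʷ proj₁ p ++ʷ v) ≡⟨ changes-after-class-walk p v ⟩
    changes c v                    ≤⟨ changes-shift c c₁ v ⟩
    suc (changes c₁ v)             ≤⟨ s≤s bound ⟩
    suc (len cw)                   ∎)
    where open ≤-Reasoning

module HLength (D H : Digraph) (ρ : Coloring D H) {m : ℕ} (cls : Fin (size D) → Fin (size D) → Fin m)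
    (compatible : ∀ u v w → Arc D u v → Arc D v w → (Arc H (ρ u v) (ρ v w) ⇔ cls u v ≡ cls v w)) where

  open ClassChanges D cls

  obstruction≡differ : ∀ {x y z} → Arc D x y → Arc D y z →
    (if adj H (ρ x y) (ρ y z) then 0 else 1) ≡ differ (cls x y) (cls y z)
  obstruction≡differ {x} {y} {z} e f =
    cong (if_then 0 else 1) (≡true⇔⇒≡does (compatible x y z e f) (cls x y ≟ cls y z))

  obstructions≡changes : ∀ {x y z} (e : Arc D x y) (w : Walk (Arc D) y z) →
    obstructions D H ρ (x ∷ verts w) ≡ changes (cls x y) w
  obstructions≡changes e []           = refl
  obstructions≡changes e (f ∷ [])     = cong (_+ 0) (obstruction≡differ e f)
  obstructions≡changes e (f ∷ g ∷ w) =
    cong₂ _+_ (obstruction≡differ e f) (obstructions≡changes f (g ∷ w))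

  Hlength≤suc-changes : ∀ c {x y} (w : Walk (Arc D) x y) → Hlength D H ρ w ≤ suc (changes c w)
  Hlength≤suc-changes c []                = s≤s z≤n
  Hlength≤suc-changes c (_∷_ {x} {y} e w) =
    s≤s (≤-trans (≤-reflexive (obstructions≡changes e w)) (m≤n+m _ (differ c (cls x y))))

  changes≤Hlength : ∀ c {x y} (w : Walk (Arc D) x y) → changes c w ≤ Hlength D H ρ w
  changes≤Hlength c []                = z≤n
  changes≤Hlength c (_∷_ {x} {y} e w) = begin
    differ c (cls x y) + changes (cls x y) w ≤⟨ +-monoˡ-≤ _ (differ≤1 c (cls x y)) ⟩
    suc (changes (cls x y) w)                ≡⟨ cong suc (sym (obstructions≡changes e w)) ⟩
    Hlength D H ρ (e ∷ w)                    ∎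
    where open ≤-Reasoning

module KernelByPaths (D : Digraph) {m : ℕ} (cls : Fin (size D) → Fin (size D) → Fin m)
    (S : Subset m) (K : Subset (size D)) where

  open ClassChanges D cls
  open DecMembership (_≟_ {size D}) using () renaming (_∈?_ to _∈ˡ?_)

  UnionArc : V → V → Set
  UnionArc = SubArc D cls (_∈ S)

  IndependentInC : Set
  IndependentInC = ∀ i j → i ∈ S → j ∈ S → CArc D cls i j → i ≡ j

  kernel⇒independent : ∀ {k l} → 2 ≤ k → IsKLKernelInC D cls k l S → IndependentInC
  kernel⇒independent 2≤k (far , _) i j i∈S j∈S ij with i ≟ j
  ... | yes i≡j = i≡j
  ... | no i≢j  = contradiction (far i j i∈S j∈S i≢j (ij ∷ [])) (<⇒≱ 2≤k)

  changes-along-union : IndependentInC → ∀ {u v y} (e : Arc D u v) → cls u v ∈ S →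
    (p : Walk UnionArc v y) → changes (cls u v) (mapʷ proj₁ p) ≡ 0
  changes-along-union independent e uv∈S []               = refl
  changes-along-union independent e uv∈S ((f , vt∈S) ∷ p) =
    cong₂ _+_ (differ-≡ (independent _ _ uv∈S vt∈S (_ , _ , _ , e , f , refl , refl)))
              (changes-along-union independent f vt∈S p)

  class⊆union : ∀ {i} → i ∈ S → ∀ {a b} → ClassArc D cls i a b → UnionArc a b
  class⊆union i∈S (e , refl) = e , i∈S

  reaches-K-within-class : IndependentInC → IsKernelByPathsInUnion D cls S K →
    ∀ {d} → d ∈ S → ClassNoSinks D cls d → ∀ w → ClassVert D cls d w → ReachesWithin K d 0 w
  reaches-K-within-class independent (_ , _ , absorbs) {d} d∈S no-sink w w∈d
    with no-sink w w∈d
  ... | w′ , (e , refl) with w′ ∈? K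
  ...   | yes w′∈K = w′ , w′∈K , e ∷ [] , ≤-reflexive (cong (_+ 0) (differ-≡ {d} refl))
  ...   | no w′∉K with absorbs w′ (w , inj₂ (e , d∈S)) w′∉K
  ...     | y , y∈K , (p , _) = y , y∈K , e ∷ mapʷ proj₁ p ,
              ≤-reflexive (cong₂ _+_ (differ-≡ {d} refl) (changes-along-union independent e d∈S p))

  reaches-mono : ∀ {c n n′ z} → n ≤ n′ → ReachesWithin K c n z → ReachesWithin K c n′ z
  reaches-mono n≤n′ (y , y∈K , w , bound) = y , y∈K , w , ≤-trans bound n≤n′

  incident-class : ∀ {x} → (∃ λ u → Arc D x u ⊎ Arc D u x) → ∃ λ c → ClassVert D cls c x
  incident-class (u , inj₁ e) = _ , u , inj₁ (e , refl)
  incident-class (u , inj₂ e) = _ , u , inj₂ (e , refl)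

  reaches-K : ∀ {k l} → NoIsolated D → WalkPreservative D cls → IsKLKernelInC D cls k l S →
    (∀ d → d ∈ S → ∀ w → ClassVert D cls d w → ReachesWithin K d 0 w) →
    ∀ x → ∃ λ c → ReachesWithin K c l x
  reaches-K {l = l} no-isolated preservative (_ , absorbs) reach x =
    from-class (proj₂ (incident-class (no-isolated x)))
    where
    from-class : ∀ {c} → ClassVert D cls c x → ∃ λ c → ReachesWithin K c l x
    from-class {c} x∈c with c ∈? S
    ... | yes c∈S = c , reaches-mono z≤n (reach c c∈S x x∈c)
    ... | no c∉S with absorbs c c∉S
    ...   | j , j∈S , cw , len≤l =
            c , reaches-mono len≤l (lift-class-walk preservative cw (reach j j∈S) x x∈c)

  in-arc : Loopless D → IsKernelByPathsInUnion D cls S K → ∀ {x} → x ∈ K → ∃ λ u → UnionArc u x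
  in-arc loopless (K⊆union , no-path , absorbs) {x} x∈K with K⊆union x x∈K
  ... | u , inj₂ ux = u , ux
  ... | w , inj₁ (e , xw∈S) with w ∈? K
  ...   | yes w∈K = ⊥-elim (no-path x w x∈K w∈K x≢w ((e , xw∈S) ∷ [] , (x≢w ∷ []) ∷ [] ∷ []))
    where
    x≢w : x ≢ w
    x≢w refl = loopless x e
  ...   | no w∉K with absorbs w (x , inj₂ (e , xw∈S)) w∉K
  ...     | y , y∈K , p with x ∈ˡ? verts (proj₁ p)
  ...       | yes x∈p = arc-into-walk (e , xw∈S) (proj₁ p) x∈p
  ...       | no x∉p  = ⊥-elim (no-path x y x∈K y∈K x≢y (∷-path (e , xw∈S) p x∉p))
    where
    x≢y : x ≢ y
    x≢y refl = x∉p (target∈verts (proj₁ p))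

  out-arc : IsKernelByPathsInUnion D cls S K → (∀ i → i ∈ S → ClassNoSinks D cls i) →
    ∀ {y} → y ∈ K → ∃ λ t → UnionArc y t
  out-arc (K⊆union , _) no-sinks {y} y∈K with K⊆union y y∈K
  ... | t , inj₁ yt = t , yt
  ... | w , inj₂ (e , wy∈S) with no-sinks _ wy∈S y (w , inj₂ (e , refl))
  ...   | t , yt = t , class⊆union wy∈S yt

  K-meets-S-class-once : IsKernelByPathsInUnion D cls S K →
    ∀ {i} → i ∈ S → ClassUnilateral D cls i →
    ∀ {x y} → x ∈ K → y ∈ K → x ≢ y → ClassVert D cls i x → ClassVert D cls i y → ⊥
  K-meets-S-class-once (_ , no-path , _) i∈S unilateral {x} {y} x∈K y∈K x≢y x∈i y∈i
    with unilateral x y x∈i y∈i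
  ... | inj₁ xy = no-path x y x∈K y∈K x≢y (mapᵖ (class⊆union i∈S) xy)
  ... | inj₂ yx = no-path y x y∈K x∈K (x≢y ∘ sym) (mapᵖ (class⊆union i∈S) yx)

  many-changes-between-K : ∀ {k l} → Loopless D → IsKLKernelInC D cls k l S →
    (∀ i → i ∈ S → ClassUnilateral D cls i) → (∀ i → i ∈ S → ClassNoSinks D cls i) →
    IsKernelByPathsInUnion D cls S K →
    ∀ {x y} → x ∈ K → y ∈ K → x ≢ y → (w : Walk (Arc D) x y) → ∃ λ c → k ≤ suc (changes c w)
  many-changes-between-K loopless (far , _) unilateral no-sinks kK {x} {y} x∈K y∈K x≢y w
    with in-arc loopless kK x∈K | out-arc kK no-sinks y∈K
  ... | u , (e , F∈S) | t , (f , G∈S) with cls u x ≟ cls y t | class-walk e w f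
  ...   | yes F≡G | _ = ⊥-elim (K-meets-S-class-once kK G∈S (unilateral _ G∈S) x∈K y∈K x≢y
                                  (u , inj₂ (e , F≡G)) (t , inj₁ (f , refl)))
  ...   | no F≢G  | cw , len≤changes = cls u x , ≤-trans (far _ _ F∈S G∈S F≢G cw) len≤changes

proposition5 : (H D : Digraph) → Loopless D → NoIsolated D →
    (ρ : Coloring D H) →
    (m : ℕ) (cls : Fin (size D) → Fin (size D) → Fin m) →
    IsHClassPartition D cls H ρ → WalkPreservative D cls →
    (k l : ℕ) → 3 ≤ k → 1 ≤ l →
    (S : Subset m) → IsKLKernelInC D cls k l S →
    (∀ i → i ∈ S → ClassUnilateral D cls i × ClassNoSinks D cls i) →
    (K : Subset (size D)) → IsKernelByPathsInUnion D cls S K →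
    IsKLHKernelByWalks D H ρ (k ∸ 1) (suc l) K
proposition5 H D loopless no-isolated ρ m cls (_ , compatible) preservative k l 3≤k _ S kS classes K kK =
  far-apart , absorbing
  where
  open ClassChanges D cls
  open HLength D H ρ cls compatible
  open KernelByPaths D cls S K

  independent : IndependentInC
  independent = kernel⇒independent (<⇒≤ 3≤k) kS

  unilateral : ∀ i → i ∈ S → ClassUnilateral D cls i
  unilateral i i∈S = proj₁ (classes i i∈S)

  no-sinks : ∀ i → i ∈ S → ClassNoSinks D cls i
  no-sinks i i∈S = proj₂ (classes i i∈S)

  far-apart : ∀ x y → x ∈ K → y ∈ K → x ≢ y → (w : Walk (Arc D) x y) → k ∸ 1 ≤ Hlength D H ρ w
  far-apart x y x∈K y∈K x≢y w with many-changes-between-K loopless kS unilateral no-sinks kK x∈K y∈K x≢y w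
  ... | c , k≤ = ∸-monoˡ-≤ 1 (≤-trans k≤ (s≤s (changes≤Hlength c w)))

  absorbing : ∀ x → x ∉ K → ∃ λ y → y ∈ K × Σ (Walk (Arc D) x y) λ w → Hlength D H ρ w ≤ suc l
  absorbing x _ with reaches-K no-isolated preservative kS
                       (λ d d∈S → reaches-K-within-class independent kK d∈S (no-sinks d d∈S)) x
  ... | c , y , y∈K , w , bound = y , y∈K , w , ≤-trans (Hlength≤suc-changes c w) (s≤s bound)
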